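{- Let $k\ge 1$ be an integer, let $$GC_k(x,q)=\sum_{n\ge 0}\sum_{\pi\in[k]^n}x^nq^{\mathrm{gkcon}(\pi)},$$ and for $j\in[k]$ let $GC_k(x,q\mid j)=\sum_{n\ge 1}\sum_{\pi\in[k]^n,\ \pi_n=j}x^nq^{\mathrm{gkcon}(\pi)}$ be the corresponding generating function restricted to nonempty words whose last letter is $j$. Then $$GC_k(x,q)=\frac{1+x(q-1)\sum_{i=1}^{k}\sum_{j=k-i+1}^{k}GC_k(x,q\mid j)}{1-kx}.$$
   Context: $[k]=\{1,2,\ldots,k\}$, and $[k]^n$ is the set of words $\pi=\pi_1\cdots\pi_n$ of length $n$ over $[k]$ (including the empty word for $n=0$). A gk-connector of $\pi$ is an index $j$ with $1\le j\le n-1$ and $\pi_j+\pi_{j+1}>k$; $\mathrm{gkcon}(\pi)$ is the number of gk-connectors of $\pi$. -}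

module Defs where

open import Data.Nat as ℕ using (ℕ; zero; suc; _∸_; _^_; _<?_; _≤?_)
open import Data.Fin as Fin using (Fin; toℕ)
open import Data.Vec as Vec using (Vec; []; _∷_; last)
open import Data.List as List using (List; []; _∷_; map; concatMap; length; filter; foldr; upTo; allFin)
open import Data.Integer as ℤ using (ℤ; +_)
open import Relation.Nullary using (does)
open import Relation.Nullary.Decidable using (_×-dec_)
open import Relation.Binary.PropositionalEquality using (_≡_)

-- Convention: a letter a : Fin k stands for the element  toℕ a + 1  of [k] = {1,…,k}.
letter : {k : ℕ} → Fin k → ℕ
letter a = suc (toℕ a)

words : (k n : ℕ) → List (Vec (Fin k) n)
words k zero    = [] ∷ []
words k (suc n) = concatMap (λ a → map (a ∷_) (words k n)) (allFin k)

gkcon : {k n : ℕ} → Vec (Fin k) n → ℕ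
gkcon []              = 0
gkcon (a ∷ [])        = 0
gkcon {k} (a ∷ b ∷ w) = (if does (k <? letter a ℕ.+ letter b) then 1 else 0) ℕ.+ gkcon (b ∷ w)
  where
  open import Data.Bool using (if_then_else_)

-- Formal power series in x and q with integer coefficients:
-- S n m is the coefficient of x^n q^m.
Series : Set
Series = ℕ → ℕ → ℤ

sumℤ : List ℤ → ℤ
sumℤ = foldr ℤ._+_ (+ 0)

_⊕_ : Series → Series → Series
(f ⊕ g) n m = f n m ℤ.+ g n m

_⊗_ : Series → Series → Series
(f ⊗ g) n m = sumℤ (map (λ a → sumℤ (map (λ c → f a c ℤ.* g (n ∸ a) (m ∸ c)) (upTo (suc m)))) (upTo (suc n)))

one : Series
one zero zero = + 1
one _    _    = + 0

X : Series
X (suc zero) zero = + 1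
X _          _    = + 0

q-1 : Series
q-1 zero zero       = ℤ.-[1+ 0 ]
q-1 zero (suc zero) = + 1
q-1 _    _          = + 0

-- 1/(1 - k x) = Σ_n k^n x^n  (the inverse of 1 - kx in the power series ring)
invOneMinus : ℕ → Series
invOneMinus k n zero    = + (k ^ n)
invOneMinus k n (suc _) = + 0

sumSeries : List Series → Series
sumSeries = foldr _⊕_ (λ _ _ → + 0)

GC : ℕ → Series
GC k n m = + length (filter (λ π → gkcon π ℕ.≟ m) (words k n))

GCl : (k : ℕ) → Fin k → Series
GCl k j zero    m = + 0
GCl k j (suc n) m =
  + length (filter (λ π → (last π Fin.≟ j) ×-dec (gkcon π ℕ.≟ m)) (words k (suc n)))

doubleSum : ℕ → Series
doubleSum k = sumSeries (map (λ i → sumSeries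
    (map (GCl k) (filter (λ j → (k ∸ letter i ℕ.+ 1) ≤? letter j) (allFin k))))
  (allFin k))

numerator : ℕ → Series
numerator k = one ⊕ (X ⊗ (q-1 ⊗ doubleSum k))

{-# OPTIONS --safe #-}
module Submission where

-- Split a nonempty word into its prefix w and its last letter b.  Appending b to w
-- creates a new gk-connector exactly when b lies in the set C(w) of letters with
-- last(w) + b > k, so  Σ_b q^gkcon(wb) = (k - |C(w)|) q^gkcon(w) + |C(w)| q^(gkcon(w) + 1).
-- Summing over all w gives
--   GC_k = 1 + k x GC_k + x (q - 1) D,   where D = Σ_w |C(w)| x^|w| q^gkcon(w),
-- and D is the double sum of the statement: a word ending in j is counted there once
-- for each i with j ≥ k - i + 1, that is, |C(w)| times.

open import Defs
open import Algebra.Properties.CommutativeSemigroup as CommSemigroupProperties using ()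
open import Data.Bool using (true; false; if_then_else_)
open import Data.Empty using (⊥)
open import Data.Fin as Fin using (Fin)
open import Data.Fin.Properties using (toℕ<n)
import Data.Integer.Properties as ℤ
open import Data.Integer.Tactic.RingSolver using (solve-∀)
open import Data.List using (List; []; _∷_; _++_; map; concatMap; length; filter; allFin; upTo; applyUpTo)
open import Data.List.Properties using (map-++; map-∘; map-cong; map-tabulate; length-tabulate)
open import Data.Nat as ℕ using (ℕ; zero; suc; _∸_; _^_; _≤_; _<_; _<?_; _≤?_; _≟_; s≤s⁻¹; z<s; s<s)
open import Data.Nat.ListAction using (sum)
open import Data.Nat.ListAction.Properties using (sum-++)
import Data.Nat.Properties as ℕ
open import Data.Vec using (Vec; []; _∷_; last; _∷ʳ_)
open import Function using (_∘_; _⇔_; mk⇔)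
open import Relation.Nullary using (Dec; does; no)
open import Relation.Nullary.Decidable using (_×-dec_; does-⇔)
open import Relation.Unary using (Decidable)
open import Relation.Binary.PropositionalEquality
open ≡-Reasoning

module _ where
  open import Data.Nat using (_+_; _*_)
  open CommSemigroupProperties ℕ.+-commutativeSemigroup using () renaming (interchange to +-interchange)
  open CommSemigroupProperties ℕ.*-commutativeSemigroup using () renaming (x∙yz≈y∙xz to *-left-comm)

  χ : {P : Set} → Dec P → ℕ
  χ P? = if does P? then 1 else 0

  χ-×-dec : {P Q : Set} (P? : Dec P) (Q? : Dec Q) → χ (P? ×-dec Q?) ≡ χ P? * χ Q?
  χ-×-dec P? Q? with does P? | does Q?
  ... | true  | true  = refl
  ... | true  | false = refl
  ... | false | _     = refl

  χ-⇔ : {P Q : Set} → P ⇔ Q → (P? : Dec P) (Q? : Dec Q) → χ P? ≡ χ Q?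
  χ-⇔ P⇔Q P? Q? = cong (λ b → if b then 1 else 0) (does-⇔ P⇔Q P? Q?)

  ∑ : {A : Set} → List A → (A → ℕ) → ℕ
  ∑ xs f = sum (map f xs)

  infixr 8 ∑
  syntax ∑ xs (λ x → e) = ∑[ x ∈ xs ] e

  module _ {A : Set} where

    ∑-cong : (xs : List A) {f g : A → ℕ} → (∀ x → f x ≡ g x) → ∑ xs f ≡ ∑ xs g
    ∑-cong xs f≗g = cong sum (map-cong f≗g xs)

    ∑-+ : (xs : List A) (f g : A → ℕ) → ∑[ x ∈ xs ] (f x + g x) ≡ ∑ xs f + ∑ xs g
    ∑-+ []       f g = refl
    ∑-+ (x ∷ xs) f g = trans (cong (f x + g x +_) (∑-+ xs f g)) (+-interchange (f x) (g x) _ _)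

    ∑-*ˡ : (xs : List A) (c : ℕ) (f : A → ℕ) → ∑[ x ∈ xs ] (c * f x) ≡ c * ∑ xs f
    ∑-*ˡ []       c f = sym (ℕ.*-zeroʳ c)
    ∑-*ˡ (x ∷ xs) c f = trans (cong (c * f x +_) (∑-*ˡ xs c f)) (sym (ℕ.*-distribˡ-+ c (f x) _))

    ∑-*ʳ : (xs : List A) (f : A → ℕ) (c : ℕ) → ∑[ x ∈ xs ] (f x * c) ≡ ∑ xs f * c
    ∑-*ʳ []       f c = refl
    ∑-*ʳ (x ∷ xs) f c = trans (cong (f x * c +_) (∑-*ʳ xs f c)) (sym (ℕ.*-distribʳ-+ c (f x) _))

    ∑-const : (xs : List A) (c : ℕ) → ∑[ x ∈ xs ] c ≡ length xs * c
    ∑-const []       c = refl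
    ∑-const (x ∷ xs) c = cong (c +_) (∑-const xs c)

    ∑-zero : (xs : List A) → ∑[ x ∈ xs ] 0 ≡ 0
    ∑-zero xs = trans (∑-const xs 0) (ℕ.*-zeroʳ (length xs))

    length-filter≡∑χ : (xs : List A) {P : A → Set} (P? : Decidable P) →
                       length (filter P? xs) ≡ ∑[ x ∈ xs ] χ (P? x)
    length-filter≡∑χ []       P? = refl
    length-filter≡∑χ (x ∷ xs) P? with does (P? x)
    ... | true  = cong suc (length-filter≡∑χ xs P?)
    ... | false = length-filter≡∑χ xs P?

    ∑-filter : (xs : List A) {P : A → Set} (P? : Decidable P) (f : A → ℕ) →
               ∑ (filter P? xs) f ≡ ∑[ x ∈ xs ] (χ (P? x) * f x)
    ∑-filter []       P? f = refl
    ∑-filter (x ∷ xs) P? f with does (P? x)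
    ... | true  = cong₂ _+_ (sym (ℕ.+-identityʳ (f x))) (∑-filter xs P? f)
    ... | false = ∑-filter xs P? f

  module _ {A B : Set} where

    ∑-map : (g : A → B) (xs : List A) (f : B → ℕ) → ∑ (map g xs) f ≡ ∑[ x ∈ xs ] f (g x)
    ∑-map g xs f = cong sum (sym (map-∘ xs))

    ∑-concatMap : (xs : List A) (g : A → List B) (f : B → ℕ) →
                  ∑ (concatMap g xs) f ≡ ∑[ x ∈ xs ] ∑ (g x) f
    ∑-concatMap []       g f = refl
    ∑-concatMap (x ∷ xs) g f = begin
      sum (map f (g x ++ concatMap g xs))
        ≡⟨ cong sum (map-++ f (g x) _) ⟩
      sum (map f (g x) ++ map f (concatMap g xs))
        ≡⟨ sum-++ (map f (g x)) _ ⟩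
      ∑ (g x) f + ∑ (concatMap g xs) f
        ≡⟨ cong (∑ (g x) f +_) (∑-concatMap xs g f) ⟩
      ∑ (g x) f + ∑[ y ∈ xs ] ∑ (g y) f ∎

    ∑-comm : (xs : List A) (ys : List B) (f : A → B → ℕ) →
             ∑[ x ∈ xs ] ∑[ y ∈ ys ] f x y ≡ ∑[ y ∈ ys ] ∑[ x ∈ xs ] f x y
    ∑-comm []       ys f = sym (∑-zero ys)
    ∑-comm (x ∷ xs) ys f = trans (cong (∑ ys (f x) +_) (∑-comm xs ys f))
                                 (sym (∑-+ ys (f x) (λ y → ∑[ x ∈ xs ] f x y)))

  ∑-allFin-suc : ∀ {k} (f : Fin (suc k) → ℕ) →
                 ∑[ i ∈ allFin (suc k) ] f i ≡ f Fin.zero + ∑[ i ∈ allFin k ] f (Fin.suc i)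
  ∑-allFin-suc {k} f = cong (λ xs → f Fin.zero + sum xs)
    (trans (map-tabulate Fin.suc f) (sym (map-tabulate (λ i → i) (f ∘ Fin.suc))))

  ∑-allFin-const : ∀ k c → ∑[ i ∈ allFin k ] c ≡ k * c
  ∑-allFin-const k c = trans (∑-const (allFin k) c) (cong (_* c) (length-tabulate {n = k} (λ i → i)))

  ∑-allFin-δ : ∀ {k} (i : Fin k) (h : Fin k → ℕ) → ∑[ j ∈ allFin k ] (χ (i Fin.≟ j) * h j) ≡ h i
  ∑-allFin-δ {suc k} Fin.zero h = begin
    ∑[ j ∈ allFin (suc k) ] (χ (Fin.zero Fin.≟ j) * h j)
      ≡⟨ ∑-allFin-suc (λ j → χ (Fin.zero Fin.≟ j) * h j) ⟩
    h Fin.zero + 0 + ∑[ j ∈ allFin k ] 0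
      ≡⟨ cong₂ _+_ (ℕ.+-identityʳ _) (∑-zero (allFin k)) ⟩
    h Fin.zero + 0
      ≡⟨ ℕ.+-identityʳ _ ⟩
    h Fin.zero ∎
  ∑-allFin-δ {suc k} (Fin.suc i) h =
    trans (∑-allFin-suc (λ j → χ (Fin.suc i Fin.≟ j) * h j)) (∑-allFin-δ i (h ∘ Fin.suc))

  ∑-fibres : ∀ {k} {A : Set} (xs : List A) (g : A → Fin k) (f : Fin k → ℕ) (h : A → ℕ) →
             ∑[ j ∈ allFin k ] (f j * ∑[ x ∈ xs ] (χ (g x Fin.≟ j) * h x))
               ≡ ∑[ x ∈ xs ] (f (g x) * h x)
  ∑-fibres {k} xs g f h = begin
    ∑[ j ∈ allFin k ] (f j * ∑[ x ∈ xs ] (χ (g x Fin.≟ j) * h x))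
      ≡⟨ ∑-cong (allFin k) (λ j → sym (∑-*ˡ xs (f j) _)) ⟩
    ∑[ j ∈ allFin k ] ∑[ x ∈ xs ] (f j * (χ (g x Fin.≟ j) * h x))
      ≡⟨ ∑-comm (allFin k) xs _ ⟩
    ∑[ x ∈ xs ] ∑[ j ∈ allFin k ] (f j * (χ (g x Fin.≟ j) * h x))
      ≡⟨ ∑-cong xs (λ x → ∑-cong (allFin k) (λ j → *-left-comm (f j) (χ (g x Fin.≟ j)) (h x))) ⟩
    ∑[ x ∈ xs ] ∑[ j ∈ allFin k ] (χ (g x Fin.≟ j) * (f j * h x))
      ≡⟨ ∑-cong xs (λ x → ∑-allFin-δ (g x) (λ j → f j * h x)) ⟩
    ∑[ x ∈ xs ] (f (g x) * h x) ∎

  ∑-words-suc : ∀ k n (f : Vec (Fin k) (suc n) → ℕ) →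
                ∑ (words k (suc n)) f ≡ ∑[ a ∈ allFin k ] ∑[ w ∈ words k n ] f (a ∷ w)
  ∑-words-suc k n f = trans (∑-concatMap (allFin k) _ f)
                            (∑-cong (allFin k) (λ a → ∑-map (a ∷_) (words k n) f))

  ∑-words-∷ʳ : ∀ k n (f : Vec (Fin k) (suc n) → ℕ) →
               ∑ (words k (suc n)) f ≡ ∑[ w ∈ words k n ] ∑[ b ∈ allFin k ] f (w ∷ʳ b)
  ∑-words-∷ʳ k zero    f = trans (∑-words-suc k 0 f)
    (trans (∑-cong (allFin k) (λ a → ℕ.+-identityʳ (f (a ∷ [])))) (sym (ℕ.+-identityʳ _)))
  ∑-words-∷ʳ k (suc n) f = begin
    ∑ (words k (suc (suc n))) f
      ≡⟨ ∑-words-suc k (suc n) f ⟩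
    ∑[ a ∈ allFin k ] ∑[ w ∈ words k (suc n) ] f (a ∷ w)
      ≡⟨ ∑-cong (allFin k) (λ a → ∑-words-∷ʳ k n (λ w → f (a ∷ w))) ⟩
    ∑[ a ∈ allFin k ] ∑[ w ∈ words k n ] ∑[ b ∈ allFin k ] f (a ∷ (w ∷ʳ b))
      ≡⟨ sym (∑-words-suc k n _) ⟩
    ∑[ w ∈ words k (suc n) ] ∑[ b ∈ allFin k ] f (w ∷ʳ b) ∎

  m∸n+1≤o⇔m<o+n : ∀ {m n o} → n ≤ m → (m ∸ n + 1 ≤ o) ⇔ (m < o + n)
  m∸n+1≤o⇔m<o+n {m} {n} {o} n≤m = mk⇔ to from
    where
    to : m ∸ n + 1 ≤ o → m < o + n
    to le = subst (_< o + n) (ℕ.m∸n+n≡m n≤m)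
                  (ℕ.+-monoˡ-< n (subst (_≤ o) (ℕ.+-comm (m ∸ n) 1) le))
    from : m < o + n → m ∸ n + 1 ≤ o
    from lt = subst (_≤ o) (ℕ.+-comm 1 (m ∸ n))
                    (ℕ.+-cancelʳ-< n (m ∸ n) o (subst (_< o + n) (sym (ℕ.m∸n+n≡m n≤m)) lt))

  χ-shift : {P : Set} (P? : Dec P) (g m : ℕ) →
            χ (g + χ P? ≟ m) + χ P? * χ (g ≟ m) ≡ χ (g ≟ m) + χ P? * χ (suc g ≟ m)
  χ-shift P? g m with does P?
  ... | true  rewrite ℕ.+-comm g 1 = begin
    χ (suc g ≟ m) + (χ (g ≟ m) + 0) ≡⟨ cong (χ (suc g ≟ m) +_) (ℕ.+-identityʳ (χ (g ≟ m))) ⟩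
    χ (suc g ≟ m) + χ (g ≟ m)       ≡⟨ ℕ.+-comm (χ (suc g ≟ m)) (χ (g ≟ m)) ⟩
    χ (g ≟ m) + χ (suc g ≟ m)       ≡⟨ cong (χ (g ≟ m) +_) (sym (ℕ.+-identityʳ (χ (suc g ≟ m)))) ⟩
    χ (g ≟ m) + (χ (suc g ≟ m) + 0) ∎
  ... | false rewrite ℕ.+-identityʳ g = refl

  module _ {k : ℕ} where

    ConnectsTo : ∀ {n} → Vec (Fin k) n → Fin k → Set
    ConnectsTo []      b = ⊥
    ConnectsTo (a ∷ w) b = k < letter (last (a ∷ w)) + letter b

    connectsTo? : ∀ {n} (w : Vec (Fin k) n) (b : Fin k) → Dec (ConnectsTo w b)
    connectsTo? []      b = no λ ()
    connectsTo? (a ∷ w) b = k <? letter (last (a ∷ w)) + letter b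

    gkcon-∷ʳ : ∀ {n} (w : Vec (Fin k) n) (b : Fin k) → gkcon (w ∷ʳ b) ≡ gkcon w + χ (connectsTo? w b)
    gkcon-∷ʳ []          b = refl
    gkcon-∷ʳ (a ∷ [])    b = ℕ.+-identityʳ _
    gkcon-∷ʳ (a ∷ c ∷ w) b = trans (cong (χ ac +_) (gkcon-∷ʳ (c ∷ w) b))
                                   (sym (ℕ.+-assoc (χ ac) (gkcon (c ∷ w)) (χ (connectsTo? (c ∷ w) b))))
      where
      ac : Dec (k < letter a + letter c)
      ac = k <? letter a + letter c

    connectingLetters : ∀ {n} → Vec (Fin k) n → ℕ
    connectingLetters w = ∑[ b ∈ allFin k ] χ (connectsTo? w b)

    innerRange? : (i j : Fin k) → Dec (k ∸ letter i + 1 ≤ letter j)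
    innerRange? i j = (k ∸ letter i + 1) ≤? letter j

    ∑χ-innerRange : ∀ {n} (w : Vec (Fin k) (suc n)) →
                    ∑[ i ∈ allFin k ] χ (innerRange? i (last w)) ≡ connectingLetters w
    ∑χ-innerRange (a ∷ w) = ∑-cong (allFin k) (λ i →
      χ-⇔ (m∸n+1≤o⇔m<o+n (toℕ<n i)) (innerRange? i (last (a ∷ w))) (connectsTo? (a ∷ w) i))

    ∑-gkcon-∷ʳ : ∀ {n} (w : Vec (Fin k) n) (m : ℕ) →
                 ∑[ b ∈ allFin k ] χ (gkcon (w ∷ʳ b) ≟ m) + connectingLetters w * χ (gkcon w ≟ m)
                   ≡ k * χ (gkcon w ≟ m) + connectingLetters w * χ (suc (gkcon w) ≟ m)
    ∑-gkcon-∷ʳ w m = begin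
      ∑[ b ∈ allFin k ] χ (gkcon (w ∷ʳ b) ≟ m) + connectingLetters w * χ (g ≟ m)
        ≡⟨ cong₂ _+_ (∑-cong (allFin k) (λ b → cong (λ t → χ (t ≟ m)) (gkcon-∷ʳ w b)))
                     (sym (∑-*ʳ (allFin k) β (χ (g ≟ m)))) ⟩
      ∑[ b ∈ allFin k ] χ (g + β b ≟ m) + ∑[ b ∈ allFin k ] (β b * χ (g ≟ m))
        ≡⟨ sym (∑-+ (allFin k) _ _) ⟩
      ∑[ b ∈ allFin k ] (χ (g + β b ≟ m) + β b * χ (g ≟ m))
        ≡⟨ ∑-cong (allFin k) (λ b → χ-shift (connectsTo? w b) g m) ⟩
      ∑[ b ∈ allFin k ] (χ (g ≟ m) + β b * χ (suc g ≟ m))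
        ≡⟨ ∑-+ (allFin k) _ _ ⟩
      ∑[ b ∈ allFin k ] χ (g ≟ m) + ∑[ b ∈ allFin k ] (β b * χ (suc g ≟ m))
        ≡⟨ cong₂ _+_ (∑-allFin-const k _) (∑-*ʳ (allFin k) β _) ⟩
      k * χ (g ≟ m) + connectingLetters w * χ (suc g ≟ m) ∎
      where
      g : ℕ
      g = gkcon w
      β : Fin k → ℕ
      β b = χ (connectsTo? w b)

  gkCount : ℕ → ℕ → ℕ → ℕ
  gkCount k n m = ∑[ π ∈ words k n ] χ (gkcon π ≟ m)

  connectingCount : ℕ → ℕ → ℕ → ℕ
  connectingCount k n m = ∑[ π ∈ words k n ] (connectingLetters π * χ (gkcon π ≟ m))

  shiftedConnectingCount : ℕ → ℕ → ℕ → ℕ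
  shiftedConnectingCount k n m = ∑[ π ∈ words k n ] (connectingLetters π * χ (suc (gkcon π) ≟ m))

  gkCount-suc : ∀ k n m →
    gkCount k (suc n) m + connectingCount k n m
      ≡ k * gkCount k n m + shiftedConnectingCount k n m
  gkCount-suc k n m = begin
    gkCount k (suc n) m + connectingCount k n m
      ≡⟨ cong (_+ connectingCount k n m) (∑-words-∷ʳ k n _) ⟩
    ∑[ w ∈ words k n ] ∑[ b ∈ allFin k ] χ (gkcon (w ∷ʳ b) ≟ m) + connectingCount k n m
      ≡⟨ sym (∑-+ (words k n) _ _) ⟩
    ∑[ w ∈ words k n ]
      (∑[ b ∈ allFin k ] χ (gkcon (w ∷ʳ b) ≟ m) + connectingLetters w * χ (gkcon w ≟ m))
      ≡⟨ ∑-cong (words k n) (λ w → ∑-gkcon-∷ʳ w m) ⟩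
    ∑[ w ∈ words k n ] (k * χ (gkcon w ≟ m) + connectingLetters w * χ (suc (gkcon w) ≟ m))
      ≡⟨ ∑-+ (words k n) _ _ ⟩
    ∑[ w ∈ words k n ] (k * χ (gkcon w ≟ m)) + shiftedConnectingCount k n m
      ≡⟨ cong (_+ shiftedConnectingCount k n m) (∑-*ˡ (words k n) k _) ⟩
    k * gkCount k n m + shiftedConnectingCount k n m ∎

  endCount : (k : ℕ) → Fin k → ℕ → ℕ → ℕ
  endCount k j zero    m = 0
  endCount k j (suc n) m = ∑[ π ∈ words k (suc n) ] (χ (last π Fin.≟ j) * χ (gkcon π ≟ m))

  ∑∑endCount≡connectingCount : ∀ k n m →
    ∑[ i ∈ allFin k ] ∑[ j ∈ filter (innerRange? i) (allFin k) ] endCount k j n m ≡ connectingCount k n m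
  ∑∑endCount≡connectingCount k zero m = begin
    ∑[ i ∈ allFin k ] ∑[ j ∈ filter (innerRange? i) (allFin k) ] 0
      ≡⟨ trans (∑-cong (allFin k) (λ i → ∑-zero (filter (innerRange? i) (allFin k))))
               (∑-zero (allFin k)) ⟩
    0
      ≡⟨ cong (λ c → c * χ (0 ≟ m) + 0) (sym (∑-zero (allFin k))) ⟩
    connectingCount k 0 m ∎
  ∑∑endCount≡connectingCount k (suc n) m = begin
    ∑[ i ∈ allFin k ] ∑[ j ∈ filter (innerRange? i) (allFin k) ] endCount k j (suc n) m
      ≡⟨ ∑-cong (allFin k) (λ i → ∑-filter (allFin k) (innerRange? i) _) ⟩
    ∑[ i ∈ allFin k ] ∑[ j ∈ allFin k ] (χ (innerRange? i j) * endCount k j (suc n) m)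
      ≡⟨ ∑-cong (allFin k) (λ i → ∑-fibres ws last (χ ∘ innerRange? i) (λ π → χ (gkcon π ≟ m))) ⟩
    ∑[ i ∈ allFin k ] ∑[ π ∈ ws ] (χ (innerRange? i (last π)) * χ (gkcon π ≟ m))
      ≡⟨ ∑-comm (allFin k) ws _ ⟩
    ∑[ π ∈ ws ] ∑[ i ∈ allFin k ] (χ (innerRange? i (last π)) * χ (gkcon π ≟ m))
      ≡⟨ ∑-cong ws (λ π → trans (∑-*ʳ (allFin k) _ _)
                                (cong (_* χ (gkcon π ≟ m)) (∑χ-innerRange π))) ⟩
    connectingCount k (suc n) m ∎
    where
    ws : List (Vec (Fin k) (suc n))
    ws = words k (suc n)

open import Data.Integer using (ℤ; +_; _+_; _*_; -_; _-_)
open CommSemigroupProperties ℤ.*-commutativeSemigroup using () renaming (x∙yz≈y∙xz to *-left-comm)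

∑ℤ : ℕ → (ℕ → ℤ) → ℤ
∑ℤ zero    g = + 0
∑ℤ (suc n) g = g 0 + ∑ℤ n (g ∘ suc)

infixr 8 ∑ℤ
syntax ∑ℤ n (λ i → e) = ∑ℤ[ i < n ] e

sumℤ-map-applyUpTo : ∀ (g : ℕ → ℤ) (f : ℕ → ℕ) n → sumℤ (map g (applyUpTo f n)) ≡ ∑ℤ n (g ∘ f)
sumℤ-map-applyUpTo g f zero    = refl
sumℤ-map-applyUpTo g f (suc n) = cong (_+_ (g (f 0))) (sumℤ-map-applyUpTo g (f ∘ suc) n)

∑ℤ-cong : ∀ n {g h : ℕ → ℤ} → (∀ i → i < n → g i ≡ h i) → ∑ℤ n g ≡ ∑ℤ n h
∑ℤ-cong zero    eq = refl
∑ℤ-cong (suc n) eq = cong₂ _+_ (eq 0 z<s) (∑ℤ-cong n (λ i i<n → eq (suc i) (s<s i<n)))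

∑ℤ-zero : ∀ n {g : ℕ → ℤ} → (∀ i → i < n → g i ≡ + 0) → ∑ℤ n g ≡ + 0
∑ℤ-zero zero    eq = refl
∑ℤ-zero (suc n) eq = cong₂ _+_ (eq 0 z<s) (∑ℤ-zero n (λ i i<n → eq (suc i) (s<s i<n)))

∑ℤ-*ˡ : ∀ n (c : ℤ) (g : ℕ → ℤ) → ∑ℤ[ i < n ] (c * g i) ≡ c * ∑ℤ n g
∑ℤ-*ˡ zero    c g = sym (ℤ.*-zeroʳ c)
∑ℤ-*ˡ (suc n) c g = trans (cong (_+_ (c * g 0)) (∑ℤ-*ˡ n c (g ∘ suc))) (sym (ℤ.*-distribˡ-+ c (g 0) _))

∑ℤ-last : ∀ n (g : ℕ → ℤ) → ∑ℤ (suc n) g ≡ ∑ℤ n g + g n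
∑ℤ-last zero    g = trans (ℤ.+-identityʳ (g 0)) (sym (ℤ.+-identityˡ (g 0)))
∑ℤ-last (suc n) g = trans (cong (_+_ (g 0)) (∑ℤ-last n (g ∘ suc))) (sym (ℤ.+-assoc (g 0) _ _))

⊗-coeff : ∀ f g n m → (f ⊗ g) n m ≡ ∑ℤ[ a < suc n ] ∑ℤ[ c < suc m ] (f a c * g (n ∸ a) (m ∸ c))
⊗-coeff f g n m = trans (sumℤ-map-applyUpTo (λ a → sumℤ (map (term a) (upTo (suc m)))) (λ a → a) (suc n))
                        (∑ℤ-cong (suc n) (λ a _ → sumℤ-map-applyUpTo (term a) (λ c → c) (suc m)))
  where
  term : ℕ → ℕ → ℤ
  term a c = f a c * g (n ∸ a) (m ∸ c)

invOneMinus-suc : ∀ k n c → invOneMinus k (suc n) c ≡ + k * invOneMinus k n c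
invOneMinus-suc k n zero    = ℤ.pos-* k (k ^ n)
invOneMinus-suc k n (suc c) = sym (ℤ.*-zeroʳ (+ k))

invOneMinus-zero-pos : ∀ k {d} → 0 < d → invOneMinus k 0 d ≡ + 0
invOneMinus-zero-pos k {suc d} _ = refl

∑ℤ-*-invOneMinus-zero : ∀ k m (h : ℕ → ℤ) → ∑ℤ[ c < suc m ] (h c * invOneMinus k 0 (m ∸ c)) ≡ h m
∑ℤ-*-invOneMinus-zero k m h = begin
  ∑ℤ[ c < suc m ] (h c * invOneMinus k 0 (m ∸ c))
    ≡⟨ ∑ℤ-last m _ ⟩
  ∑ℤ[ c < m ] (h c * invOneMinus k 0 (m ∸ c)) + h m * invOneMinus k 0 (m ∸ m)
    ≡⟨ cong₂ _+_ (∑ℤ-zero m (λ c c<m → trans (cong (h c *_) (invOneMinus-zero-pos k (ℕ.m<n⇒0<n∸m c<m)))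
                                            (ℤ.*-zeroʳ (h c))))
                 (cong (λ d → h m * invOneMinus k 0 d) (ℕ.n∸n≡0 m)) ⟩
  + 0 + h m * + 1
    ≡⟨ trans (ℤ.+-identityˡ _) (ℤ.*-identityʳ (h m)) ⟩
  h m ∎

⊗-invOneMinus-zero : ∀ k f m → (f ⊗ invOneMinus k) 0 m ≡ f 0 m
⊗-invOneMinus-zero k f m =
  trans (⊗-coeff f (invOneMinus k) 0 m) (trans (ℤ.+-identityʳ _) (∑ℤ-*-invOneMinus-zero k m (f 0)))

⊗-invOneMinus-suc : ∀ k f n m →
  (f ⊗ invOneMinus k) (suc n) m ≡ + k * (f ⊗ invOneMinus k) n m + f (suc n) m
⊗-invOneMinus-suc k f n m = begin
  (f ⊗ invOneMinus k) (suc n) m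
    ≡⟨ ⊗-coeff f (invOneMinus k) (suc n) m ⟩
  ∑ℤ[ a < suc (suc n) ] column (suc n) a
    ≡⟨ ∑ℤ-last (suc n) (column (suc n)) ⟩
  ∑ℤ[ a < suc n ] column (suc n) a + column (suc n) (suc n)
    ≡⟨ cong₂ _+_ (∑ℤ-cong (suc n) (λ a a<1+n → column-suc a (s≤s⁻¹ a<1+n))) last-column ⟩
  ∑ℤ[ a < suc n ] (+ k * column n a) + f (suc n) m
    ≡⟨ cong (_+ f (suc n) m) (∑ℤ-*ˡ (suc n) (+ k) (column n)) ⟩
  + k * ∑ℤ[ a < suc n ] column n a + f (suc n) m
    ≡⟨ cong (λ t → + k * t + f (suc n) m) (sym (⊗-coeff f (invOneMinus k) n m)) ⟩
  + k * (f ⊗ invOneMinus k) n m + f (suc n) m ∎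
  where
  column : ℕ → ℕ → ℤ
  column l a = ∑ℤ[ c < suc m ] (f a c * invOneMinus k (l ∸ a) (m ∸ c))

  column-suc : ∀ a → a ≤ n → column (suc n) a ≡ + k * column n a
  column-suc a a≤n = begin
    column (suc n) a
      ≡⟨ cong (λ d → ∑ℤ[ c < suc m ] (f a c * invOneMinus k d (m ∸ c))) (ℕ.+-∸-assoc 1 a≤n) ⟩
    ∑ℤ[ c < suc m ] (f a c * invOneMinus k (suc (n ∸ a)) (m ∸ c))
      ≡⟨ ∑ℤ-cong (suc m) (λ c _ → trans (cong (f a c *_) (invOneMinus-suc k (n ∸ a) (m ∸ c)))
                                         (*-left-comm (f a c) (+ k) _)) ⟩
    ∑ℤ[ c < suc m ] (+ k * (f a c * invOneMinus k (n ∸ a) (m ∸ c)))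
      ≡⟨ ∑ℤ-*ˡ (suc m) (+ k) (λ c → f a c * invOneMinus k (n ∸ a) (m ∸ c)) ⟩
    + k * column n a ∎

  last-column : column (suc n) (suc n) ≡ f (suc n) m
  last-column = trans (cong (λ d → ∑ℤ[ c < suc m ] (f (suc n) c * invOneMinus k d (m ∸ c))) (ℕ.n∸n≡0 n))
                      (∑ℤ-*-invOneMinus-zero k m (f (suc n)))

X⊗-zero : ∀ h m → (X ⊗ h) 0 m ≡ + 0
X⊗-zero h m = trans (⊗-coeff X h 0 m) (trans (ℤ.+-identityʳ _) (∑ℤ-zero (suc m) (λ _ _ → refl)))

X⊗-suc : ∀ h n m → (X ⊗ h) (suc n) m ≡ h n m
X⊗-suc h n m = begin
  (X ⊗ h) (suc n) m
    ≡⟨ ⊗-coeff X h (suc n) m ⟩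
  ∑ℤ[ c < suc m ] (X 0 c * h (suc n) (m ∸ c))
    + ((X 1 0 * h n m + ∑ℤ[ c < m ] (X 1 (suc c) * h n (m ∸ suc c)))
       + ∑ℤ[ a < n ] ∑ℤ[ c < suc m ] (X (suc (suc a)) c * h (n ∸ suc a) (m ∸ c)))
    ≡⟨ cong₂ _+_ (∑ℤ-zero (suc m) (λ _ _ → refl))
                 (cong₂ _+_ (cong₂ _+_ (ℤ.*-identityˡ (h n m)) (∑ℤ-zero m (λ _ _ → refl)))
                            (∑ℤ-zero n (λ _ _ → ∑ℤ-zero (suc m) (λ _ _ → refl)))) ⟩
  + 0 + ((h n m + + 0) + + 0)
    ≡⟨ trans (ℤ.+-identityˡ _) (trans (ℤ.+-identityʳ _) (ℤ.+-identityʳ (h n m))) ⟩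
  h n m ∎

qTimes : Series → Series
qTimes f n zero    = + 0
qTimes f n (suc m) = f n m

q-1⊗ : ∀ f n m → (q-1 ⊗ f) n m ≡ qTimes f n m - f n m
q-1⊗ f n m = begin
  (q-1 ⊗ f) n m
    ≡⟨ ⊗-coeff q-1 f n m ⟩
  ∑ℤ[ c < suc m ] (q-1 0 c * f n (m ∸ c))
    + ∑ℤ[ a < n ] ∑ℤ[ c < suc m ] (q-1 (suc a) c * f (n ∸ suc a) (m ∸ c))
    ≡⟨ cong₂ _+_ (constant-row m) (∑ℤ-zero n (λ _ _ → ∑ℤ-zero (suc m) (λ _ _ → refl))) ⟩
  - f n m + qTimes f n m + + 0
    ≡⟨ trans (ℤ.+-identityʳ _) (ℤ.+-comm (- f n m) _) ⟩
  qTimes f n m - f n m ∎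
  where
  constant-row : ∀ m → ∑ℤ[ c < suc m ] (q-1 0 c * f n (m ∸ c)) ≡ - f n m + qTimes f n m
  constant-row zero    = cong (_+ + 0) (ℤ.-1*i≡-i (f n 0))
  constant-row (suc m) = cong₂ _+_ (ℤ.-1*i≡-i (f n (suc m)))
    (trans (cong₂ _+_ (ℤ.*-identityˡ (f n m)) (∑ℤ-zero m (λ _ _ → refl))) (ℤ.+-identityʳ (f n m)))

numerator-zero : ∀ k m → numerator k 0 m ≡ one 0 m
numerator-zero k m = trans (cong (_+_ (one 0 m)) (X⊗-zero (q-1 ⊗ doubleSum k) m)) (ℤ.+-identityʳ (one 0 m))

numerator-suc : ∀ k n m → numerator k (suc n) m ≡ qTimes (doubleSum k) n m - doubleSum k n m
numerator-suc k n m =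
  trans (ℤ.+-identityˡ _) (trans (X⊗-suc (q-1 ⊗ doubleSum k) n m) (q-1⊗ (doubleSum k) n m))

sumSeries-coeff : ∀ {A : Set} (F : A → Series) (f : A → ℕ) (xs : List A) n m →
                  (∀ x → F x n m ≡ + f x) → sumSeries (map F xs) n m ≡ + ∑ xs f
sumSeries-coeff F f []       n m eq = refl
sumSeries-coeff F f (x ∷ xs) n m eq =
  trans (cong₂ _+_ (eq x) (sumSeries-coeff F f xs n m eq)) (sym (ℤ.pos-+ (f x) _))

GC-coeff : ∀ k n m → GC k n m ≡ + gkCount k n m
GC-coeff k n m = cong +_ (length-filter≡∑χ (words k n) (λ π → gkcon π ≟ m))

GC-zero : ∀ k m → GC k 0 m ≡ one 0 m
GC-zero k zero    = refl
GC-zero k (suc m) = refl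

GCl-coeff : ∀ k j n m → GCl k j n m ≡ + endCount k j n m
GCl-coeff k j zero    m = refl
GCl-coeff k j (suc n) m = cong +_ (trans (length-filter≡∑χ (words k (suc n)) _)
  (∑-cong (words k (suc n)) (λ π → χ-×-dec (last π Fin.≟ j) (gkcon π ≟ m))))

doubleSum-coeff : ∀ k n m → doubleSum k n m ≡ + connectingCount k n m
doubleSum-coeff k n m = trans
  (sumSeries-coeff _ _ (allFin k) n m (λ i →
    sumSeries-coeff (GCl k) (λ j → endCount k j n m) (filter (innerRange? i) (allFin k)) n m
      (λ j → GCl-coeff k j n m)))
  (cong +_ (∑∑endCount≡connectingCount k n m))

qTimes-doubleSum-coeff : ∀ k n m →
  qTimes (doubleSum k) n m ≡ + shiftedConnectingCount k n m
qTimes-doubleSum-coeff k n zero    = cong +_ (sym (trans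
  (∑-cong (words k n) (λ π → ℕ.*-zeroʳ (connectingLetters π))) (∑-zero (words k n))))
qTimes-doubleSum-coeff k n (suc m) = doubleSum-coeff k n m

m+n≡o+p⇒m≡o+[p-n] : ∀ {m n o p} → m ℕ.+ n ≡ o ℕ.+ p → + m ≡ + o + (+ p - + n)
m+n≡o+p⇒m≡o+[p-n] {m} {n} {o} {p} eq = begin
  + m               ≡⟨ x≡x+y-y (+ m) (+ n) ⟩
  + m + + n - + n   ≡⟨ cong (_- + n) (trans (sym (ℤ.pos-+ m n)) (trans (cong +_ eq) (ℤ.pos-+ o p))) ⟩
  + o + + p - + n   ≡⟨ ℤ.+-assoc (+ o) (+ p) (- + n) ⟩
  + o + (+ p - + n) ∎
  where
  x≡x+y-y : ∀ (x y : ℤ) → x ≡ x + y - y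
  x≡x+y-y = solve-∀

GC-suc : ∀ k n m → GC k (suc n) m ≡ + k * GC k n m + numerator k (suc n) m
GC-suc k n m = begin
  GC k (suc n) m
    ≡⟨ GC-coeff k (suc n) m ⟩
  + gkCount k (suc n) m
    ≡⟨ m+n≡o+p⇒m≡o+[p-n] (gkCount-suc k n m) ⟩
  + (k ℕ.* gkCount k n m)
    + (+ shiftedConnectingCount k n m - + connectingCount k n m)
    ≡⟨ cong₂ _+_ (trans (ℤ.pos-* k _) (cong (+ k *_) (sym (GC-coeff k n m))))
                 (cong₂ _-_ (sym (qTimes-doubleSum-coeff k n m)) (sym (doubleSum-coeff k n m))) ⟩
  + k * GC k n m + (qTimes (doubleSum k) n m - doubleSum k n m)
    ≡⟨ cong (_+_ (+ k * GC k n m)) (sym (numerator-suc k n m)) ⟩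
  + k * GC k n m + numerator k (suc n) m ∎

theorem2 : (k : ℕ) → 1 ≤ k →
    ∀ (n m : ℕ) → GC k n m ≡ (numerator k ⊗ invOneMinus k) n m
theorem2 k _ zero m = begin
  GC k 0 m                          ≡⟨ GC-zero k m ⟩
  one 0 m                           ≡⟨ sym (numerator-zero k m) ⟩
  numerator k 0 m                   ≡⟨ sym (⊗-invOneMinus-zero k (numerator k) m) ⟩
  (numerator k ⊗ invOneMinus k) 0 m ∎
theorem2 k 1≤k (suc n) m = begin
  GC k (suc n) m
    ≡⟨ GC-suc k n m ⟩
  + k * GC k n m + numerator k (suc n) m
    ≡⟨ cong (λ t → + k * t + numerator k (suc n) m) (theorem2 k 1≤k n m) ⟩
  + k * (numerator k ⊗ invOneMinus k) n m + numerator k (suc n) m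
    ≡⟨ sym (⊗-invOneMinus-suc k (numerator k) n m) ⟩
  (numerator k ⊗ invOneMinus k) (suc n) m ∎
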